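{- A permutation $\pi\in B_n$ is a $B$-arc permutation if and only if it avoids the following $24$ patterns (each $\pm$ ranging over both signs): $$[\pm2,1,3],[\pm2,3,1],[\pm3,1,-2],[\pm3,-2,1],[\pm1,2,-3],[\pm1,-3,2],$$ $$[\pm2,-1,-3],[\pm2,-3,-1],[\pm3,-1,2],[\pm3,2,-1],[\pm1,-2,3],[\pm1,3,-2].$$
   Context: $B_n$ is the group of bijections $\pi$ of $\{\pm1,\dots,\pm n\}$ with $\pi(-a)=-\pi(a)$, written $\pi=[\pi(1),\dots,\pi(n)]$. Let $\mathcal{O}_n$ be a circle with $2n$ points labeled $-1,-2,\dots,-n,1,2,\dots,n$ in clockwise order (equivalently, identify $j$ with $j\in\mathbb{Z}_{2n}$ and $-j$ with $n+j\in\mathbb{Z}_{2n}$); an interval in $\mathcal{O}_n$ is a set of cyclically consecutive points. $\pi\in B_n$ is a $B$-arc permutation if for every $1\le j\le n$ the set $\{\pi(j),\dots,\pi(n)\}$ is an interval in $\mathcal{O}_n$. Pattern containment: $\pi\in B_n$ contains $\sigma\in B_k$ if there are indices $i_1<\dots<i_k$ such that $\pi(i_j)$ and $\sigma(j)$ have the same sign for all $j$ and $|\pi(i_1)|\cdots|\pi(i_k)|$ is in the same relative order as $|\sigma(1)|\cdots|\sigma(k)|$; otherwise $\pi$ avoids $\sigma$. -}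

module Defs where

open import Data.Nat using (ℕ; zero; suc; _+_; _∸_; _≤_; _<_)
open import Data.Integer using (ℤ; +_; -[1+_]; ∣_∣; sign; -_)
open import Data.Fin using (Fin) renaming (_<_ to _<ᶠ_; _≤_ to _≤ᶠ_)
open import Data.Vec using (Vec; []; _∷_; lookup)
open import Data.List using (List; []; _∷_)
open import Data.Product using (Σ; ∃; _×_; _,_)
open import Data.Sum using (_⊎_)
open import Relation.Binary.PropositionalEquality using (_≡_)
open import Function.Bundles using (_⇔_)

-- An element of B_n in window notation [π(1),…,π(n)] (0-indexed by Fin n):
-- the absolute values |π(1)|,…,|π(n)| form a permutation of {1,…,n}.
-- (A signed bijection of {±1,…,±n} is determined by, and determines, this window.)
IsSignedPerm : (n : ℕ) → (Fin n → ℤ) → Set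
IsSignedPerm n π =
  (∀ i → 1 ≤ ∣ π i ∣ × ∣ π i ∣ ≤ n) × (∀ i j → ∣ π i ∣ ≡ ∣ π j ∣ → i ≡ j)

-- Position of a label on the circle O_n, as an element of {0,…,2n-1} ≅ ℤ_{2n}.
-- Clockwise order -1,-2,…,-n,1,2,…,n; we put 1 at position 0, so j ↦ j-1 and
-- -j ↦ n+j-1.  (This is the paper's identification rotated by one step,
-- which does not change which sets are intervals.)
pos : ℕ → ℤ → ℕ
pos n (+ m)     = m ∸ 1
pos n -[1+ m ]  = n + m

InArc : ℕ → ℕ → ℕ → ℕ → Set
InArc n a ℓ p = (a ≤ p × p < a + ℓ) ⊎ (p + (n + n) < a + ℓ)

IsInterval : (n : ℕ) → (ℕ → Set) → Set
IsInterval n S =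
  Σ ℕ λ a → Σ ℕ λ ℓ → a < n + n × ℓ ≤ n + n ×
    (∀ p → p < n + n → (S p ⇔ InArc n a ℓ p))

Tail : (n : ℕ) → (Fin n → ℤ) → Fin n → ℕ → Set
Tail n π j p = Σ (Fin n) λ k → j ≤ᶠ k × pos n (π k) ≡ p

IsBArc : (n : ℕ) → (Fin n → ℤ) → Set
IsBArc n π = ∀ j → IsInterval n (Tail n π j)

Contains : {n k : ℕ} → (Fin n → ℤ) → (Fin k → ℤ) → Set
Contains {n} {k} π σ =
  Σ (Fin k → Fin n) λ f →
    (∀ a b → a <ᶠ b → f a <ᶠ f b) ×
    (∀ a → sign (π (f a)) ≡ sign (σ a)) ×
    (∀ a b → (∣ π (f a) ∣ < ∣ π (f b) ∣ ⇔ ∣ σ a ∣ < ∣ σ b ∣))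

Avoids : {n k : ℕ} → (Fin n → ℤ) → (Fin k → ℤ) → Set
Avoids π σ = Contains π σ → Data.Empty.⊥
  where import Data.Empty

private
  p : ℕ → ℤ
  p m = + m
  m : ℕ → ℤ
  m x = - (+ x)

patterns : List (Vec ℤ 3)
patterns =
  (p 2 ∷ p 1 ∷ p 3 ∷ []) ∷ (m 2 ∷ p 1 ∷ p 3 ∷ []) ∷
  (p 2 ∷ p 3 ∷ p 1 ∷ []) ∷ (m 2 ∷ p 3 ∷ p 1 ∷ []) ∷
  (p 3 ∷ p 1 ∷ m 2 ∷ []) ∷ (m 3 ∷ p 1 ∷ m 2 ∷ []) ∷
  (p 3 ∷ m 2 ∷ p 1 ∷ []) ∷ (m 3 ∷ m 2 ∷ p 1 ∷ []) ∷
  (p 1 ∷ p 2 ∷ m 3 ∷ []) ∷ (m 1 ∷ p 2 ∷ m 3 ∷ []) ∷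
  (p 1 ∷ m 3 ∷ p 2 ∷ []) ∷ (m 1 ∷ m 3 ∷ p 2 ∷ []) ∷
  (p 2 ∷ m 1 ∷ m 3 ∷ []) ∷ (m 2 ∷ m 1 ∷ m 3 ∷ []) ∷
  (p 2 ∷ m 3 ∷ m 1 ∷ []) ∷ (m 2 ∷ m 3 ∷ m 1 ∷ []) ∷
  (p 3 ∷ m 1 ∷ p 2 ∷ []) ∷ (m 3 ∷ m 1 ∷ p 2 ∷ []) ∷
  (p 3 ∷ p 2 ∷ m 1 ∷ []) ∷ (m 3 ∷ p 2 ∷ m 1 ∷ []) ∷
  (p 1 ∷ m 2 ∷ p 3 ∷ []) ∷ (m 1 ∷ m 2 ∷ p 3 ∷ []) ∷
  (p 1 ∷ p 3 ∷ m 2 ∷ []) ∷ (m 1 ∷ p 3 ∷ m 2 ∷ []) ∷ []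

module Submission where

-- A label x ∈ {±1,…,±n} and its antipode -x cut the circle O_n into
-- two open half-circles; y is *ahead* of x if it lies in the clockwise one.
-- Whether y is ahead of x depends only on the signs of x, y and on how |x|
-- and |y| compare (aheadᵇ).  Call π *unseparated* if for all i < j < k the
-- labels π j and π k lie on the same side of π i.  Then
--   (1) B-arc ⇒ unseparated: the tail {π j, …} is an arc avoiding π i and
--       -π i, hence contained in one half-circle of π i;
--   (2) unseparated ⇒ B-arc: by backward induction on j, the arc {π (j+1), …}
--       grows by π j, which must sit at one of its two ends — elsewhere some
--       earlier label π i would separate π j from the arc;
--   (3) unseparated ⇔ avoiding the patterns: the 24 patterns are exactly the
--       standardised triples whose first entry separates the other two.

open import Defs
open import Data.Nat using (ℕ)
open import Data.Integer using (ℤ)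
open import Data.Fin using (Fin)
open import Data.Vec using (lookup)
open import Data.List.Relation.Unary.All using (All)
open import Function.Bundles using (_⇔_)

open import Data.Nat
  using (zero; suc; pred; _+_; _∸_; _≤_; _<_; _<ᵇ_; z≤n; s≤s; s≤s⁻¹; z<s; s<s; s<s⁻¹; _≤?_; _<?_)
open import Data.Nat.Properties renaming (_≟_ to _≟ℕ_)
open import Data.Nat.DivMod using (_%_; m%n<n; m%n%n≡m%n; [m+n]%n≡m%n; %-distribˡ-+; m<n⇒m%n≡m)
open import Algebra.Properties.CommutativeSemigroup +-commutativeSemigroup using (x∙yz≈y∙xz)
open import Data.Integer using (_◃_; +_; -[1+_]; ∣_∣; sign; -_)
open import Data.Integer.Properties using (∣-i∣≡∣i∣; sign-◃; abs-◃)
import Data.Integer as ℤ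
open import Data.Sign using (Sign)
import Data.Sign as Sign
open import Data.Bool using (Bool; true; false; not; _xor_; T)
import Data.Bool as Bool
open import Data.Fin using (zero; suc; toℕ; fromℕ<; punchOut) renaming (_<_ to _<ᶠ_; _≤_ to _≤ᶠ_)
open import Data.Fin.Properties
  using (any?; punchOut-injective; injective⇒≤; fromℕ<-injective; toℕ-fromℕ<; toℕ-injective; toℕ<n)
  renaming (all? to all-fin?; _≟_ to _≟ᶠ_)
open import Data.Vec using (Vec; []; _∷_)
open import Data.Vec.Properties using (≡-dec)
open import Data.List using (List; []; _∷_)
open import Data.List.Membership.Propositional using (_∈_)
open import Data.List.Membership.DecPropositional (≡-dec {n = 3} ℤ._≟_) using (_∈?_)
open import Data.List.Relation.Unary.Any using (here; there)
open import Data.List.Relation.Unary.All as All using (all?)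
open import Data.Product using (Σ; ∃; _×_; _,_; proj₁; proj₂)
open import Data.Sum using (_⊎_; inj₁; inj₂)
open import Data.Empty using (⊥; ⊥-elim)
open import Relation.Nullary using (¬_; Dec; yes; no)
open import Relation.Nullary.Decidable using (⌊_⌋; toWitness; ¬?; _→-dec_)
open import Relation.Binary using (tri<; tri≈; tri>)
open import Relation.Binary.PropositionalEquality
open import Function.Bundles using (mk⇔; Equivalence)
open Equivalence using (to; from)
open import Function.Construct.Identity using (⇔-id)
open import Function.Construct.Symmetry using (⇔-sym)
open import Function.Construct.Composition using (_⇔-∘_)

_⇔∘_ : ∀ {A B C : Set} → A ⇔ B → B ⇔ C → A ⇔ C
f ⇔∘ g = g ⇔-∘ f
infixr 5 _⇔∘_

-- aheadᵇ x y: is the label y ahead of (clockwise within half a turn from)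
-- the label x?  On O_n the labels run 1,…,n,-1,…,-n clockwise, so this only
-- depends on whether the signs agree and on how |x| and |y| compare
-- (see aheadᵇ-correct).
aheadᵇ : ℤ → ℤ → Bool
aheadᵇ x y = ⌊ sign x Sign.≟ sign y ⌋ xor (∣ y ∣ <ᵇ ∣ x ∣)

T-<ᵇ : ∀ {a b} → (T (a <ᵇ b) ⇔ a < b)
T-<ᵇ {a} {b} = mk⇔ (<ᵇ⇒< a b) <⇒<ᵇ

T-not-<ᵇ : ∀ {a b} → a ≢ b → (T (not (b <ᵇ a)) ⇔ a < b)
T-not-<ᵇ {a} {b} a≢b with b <ᵇ a in eq
... | true = mk⇔ (λ ()) (λ a<b → <-asym a<b (<ᵇ⇒< b a (subst T (sym eq) _)))
... | false = mk⇔ (λ _ → ≤∧≢⇒< (≮⇒≥ (λ b<a → subst T eq (<⇒<ᵇ b<a))) a≢b) (λ _ → _)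

module Circle (m : ℕ) where

  n N : ℕ
  n = suc m
  N = n + n

  -- Congruence modulo N = 2n.  It is a record so that the middle term of a
  -- chain x ≡ₘ y ≡ₘ z stays inferable (_%_ is not injective).
  record _≡ₘ_ (x y : ℕ) : Set where
    constructor mk
    field un : x % N ≡ y % N
  infix 4 _≡ₘ_

  symₘ : ∀ {x y} → x ≡ₘ y → y ≡ₘ x
  symₘ (mk e) = mk (sym e)

  _∙_ : ∀ {x y z} → x ≡ₘ y → y ≡ₘ z → x ≡ₘ z
  mk e ∙ mk f = mk (trans e f)
  infixr 5 _∙_

  eqₘ : ∀ {x y} → x ≡ y → x ≡ₘ y
  eqₘ refl = mk refl

  +ₘ : ∀ {x x'} y → x ≡ₘ x' → x + y ≡ₘ x' + y
  +ₘ {x} {x'} y (mk e) = mk (trans (%-distribˡ-+ x y N)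
    (trans (cong (λ z → (z + y % N) % N) e) (sym (%-distribˡ-+ x' y N))))

  ₘ+ : ∀ y {x x'} → x ≡ₘ x' → y + x ≡ₘ y + x'
  ₘ+ y {x} {x'} e = eqₘ (+-comm y x) ∙ +ₘ y e ∙ eqₘ (+-comm x' y)

  +N : ∀ x → x + N ≡ₘ x
  +N x = mk ([m+n]%n≡m%n x N)

  %N : ∀ x → x % N ≡ₘ x
  %N x = mk (m%n%n≡m%n x N)

  ≡ₘ-small : ∀ {x y} → x < N → y < N → x ≡ₘ y → x ≡ y
  ≡ₘ-small x<N y<N (mk e) = trans (sym (m<n⇒m%n≡m x<N)) (trans e (m<n⇒m%n≡m y<N))

  +n+n : ∀ x → x + n + n ≡ₘ x
  +n+n x = eqₘ (+-assoc x n n) ∙ +N x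

  -- The clockwise offset of the point p from the base point a, in ℤ_N.
  -- It is kept opaque: all that is used is its specification.
  opaque
    offset : ℕ → ℕ → ℕ
    offset a p = (p + (N ∸ a)) % N

    offset<N : ∀ a p → offset a p < N
    offset<N a p = m%n<n (p + (N ∸ a)) N

    offset-spec : ∀ {a} p → a ≤ N → a + offset a p ≡ₘ p
    offset-spec {a} p a≤N = ₘ+ a (%N (p + (N ∸ a))) ∙ eqₘ eq ∙ +N p
      where
      eq : a + (p + (N ∸ a)) ≡ p + N
      eq = trans (x∙yz≈y∙xz a p (N ∸ a)) (cong (_+_ p) (m+[n∸m]≡n a≤N))

    offset-unique : ∀ {a p o} → a ≤ N → o < N → a + o ≡ₘ p → offset a p ≡ o
    offset-unique {a} {p} {o} a≤N o<N e =
      ≡ₘ-small (offset<N a p) o<N (%N _ ∙ +ₘ (N ∸ a) (symₘ e) ∙ eqₘ eq ∙ +N o)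
      where
      eq : a + o + (N ∸ a) ≡ o + N
      eq = trans (trans (+-assoc a o (N ∸ a)) (x∙yz≈y∙xz a o (N ∸ a))) (cong (_+_ o) (m+[n∸m]≡n a≤N))

  offset-exact : ∀ {a p o} → a ≤ N → o < N → (a + o ≡ p ⊎ a + o ≡ p + N) → offset a p ≡ o
  offset-exact a≤N o<N (inj₁ e) = offset-unique a≤N o<N (eqₘ e)
  offset-exact {p = p} a≤N o<N (inj₂ e) = offset-unique a≤N o<N (eqₘ e ∙ +N p)

  offset-cases : ∀ {a p} → a < N → p < N →
                 (a + offset a p ≡ p) ⊎ (p < a × a + offset a p ≡ p + N)
  offset-cases {a} {p} a<N p<N with a ≤? p
  ... | yes a≤p = inj₁ (subst (λ o → a + o ≡ p) (sym off≡) e)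
    where
    e : a + (p ∸ a) ≡ p
    e = m+[n∸m]≡n a≤p
    off≡ : offset a p ≡ p ∸ a
    off≡ = offset-exact (<⇒≤ a<N) (≤-<-trans (m∸n≤m p a) p<N) (inj₁ e)
  ... | no a≰p = inj₂ (p<a , subst (λ o → a + o ≡ p + N) (sym off≡) e)
    where
    p<a : p < a
    p<a = ≰⇒> a≰p
    e : a + (p + N ∸ a) ≡ p + N
    e = m+[n∸m]≡n (≤-trans (<⇒≤ a<N) (m≤n+m N p))
    off≡ : offset a p ≡ p + N ∸ a
    off≡ = offset-exact (<⇒≤ a<N)
      (+-cancelˡ-< a _ N (subst (_< a + N) (sym e) (+-monoˡ-< N p<a))) (inj₂ e)

  offset-comp : ∀ {a u} p → a ≤ N → u ≤ N → offset (offset a u) (offset a p) ≡ offset u p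
  offset-comp {a} {u} p a≤N u≤N = sym (offset-unique u≤N (offset<N _ _) chain)
    where
    c : ℕ
    c = offset (offset a u) (offset a p)
    chain : u + c ≡ₘ p
    chain = +ₘ c (symₘ (offset-spec u a≤N)) ∙ eqₘ (+-assoc a (offset a u) c)
      ∙ ₘ+ a (offset-spec (offset a p) (<⇒≤ (offset<N a u))) ∙ offset-spec p a≤N

  offset-injective : ∀ {a p q} → a ≤ N → p < N → q < N → offset a p ≡ offset a q → p ≡ q
  offset-injective {a} {p} {q} a≤N p<N q<N e = ≡ₘ-small p<N q<N
    (symₘ (offset-spec p a≤N) ∙ eqₘ (cong (_+_ a) e) ∙ offset-spec q a≤N)

  offset-self : ∀ a → a < N → offset a a ≡ 0
  offset-self a a<N = offset-exact (<⇒≤ a<N) z<s (inj₁ (+-identityʳ a))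

  offset-at : ∀ {a o} → a < N → o < N → offset a ((a + o) % N) ≡ o
  offset-at {a} {o} a<N o<N = offset-unique (<⇒≤ a<N) o<N (symₘ (%N (a + o)))

  offset-shift : ∀ {a q c u} → a ≤ N → q + c ≡ₘ u → offset a q + c ≡ₘ offset a u
  offset-shift {a} {q} {c} {u} a≤N e =
    symₘ (%N _) ∙ eqₘ (sym (offset-unique a≤N (m%n<n (offset a q + c) N) chain))
    where
    chain : a + (offset a q + c) % N ≡ₘ u
    chain = ₘ+ a (%N _) ∙ eqₘ (sym (+-assoc a _ c)) ∙ +ₘ c (offset-spec q a≤N) ∙ e

  inArc⇔offset : ∀ {a ℓ p} → a < N → ℓ ≤ N → p < N → (InArc n a ℓ p ⇔ offset a p < ℓ)
  inArc⇔offset {a} {ℓ} a<N ℓ≤N p<N = arc (offset-cases a<N p<N)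
    where
    arc : ∀ {o p} → (a + o ≡ p) ⊎ (p < a × a + o ≡ p + N) → (InArc n a ℓ p ⇔ o < ℓ)
    arc {o} (inj₁ refl) = mk⇔
      (λ { (inj₁ (_ , h)) → +-cancelˡ-< a o ℓ h
         ; (inj₂ h) → ⊥-elim (<⇒≱ h (≤-trans (+-monoʳ-≤ a ℓ≤N) (+-monoˡ-≤ N (m≤m+n a o)))) })
      (λ h → inj₁ (m≤m+n a o , +-monoʳ-< a h))
    arc {o} (inj₂ (p<a , e)) = mk⇔
      (λ { (inj₁ (a≤p , _)) → ⊥-elim (<⇒≱ p<a a≤p)
         ; (inj₂ h) → +-cancelˡ-< a o ℓ (subst (_< a + ℓ) (sym e) h) })
      (λ h → inj₂ (subst (_< a + ℓ) e (+-monoʳ-< a h)))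

  -- Ahead u p: the point p lies in the open half-circle clockwise from u.
  Ahead : ℕ → ℕ → Set
  Ahead u p = (u < p × p < u + n) ⊎ (p + n < u)

  ahead⇔offset : ∀ {u p} → u < N → p < N → (Ahead u p ⇔ (0 < offset u p × offset u p < n))
  ahead⇔offset {u} u<N p<N = half (offset-cases u<N p<N)
    where
    half : ∀ {o p} → (u + o ≡ p) ⊎ (p < u × u + o ≡ p + N) → (Ahead u p ⇔ (0 < o × o < n))
    half {o} (inj₁ refl) = mk⇔
      (λ { (inj₁ (u<p , h)) → +-cancelˡ-< u 0 o (subst (_< u + o) (sym (+-identityʳ u)) u<p)
                             , +-cancelˡ-< u o n h
         ; (inj₂ h) → ⊥-elim (<⇒≱ h (≤-trans (m≤m+n u o) (m≤m+n (u + o) n))) })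
      (λ (o>0 , o<n) → inj₁ (m<m+n u o>0 , +-monoʳ-< u o<n))
    half {o} {p} (inj₂ (p<u , e)) = mk⇔
      (λ { (inj₁ (u<p , _)) → ⊥-elim (<-asym u<p p<u)
         ; (inj₂ h) → o>0 , +-cancelˡ-< u o n (subst (_< u + n) e' (+-monoˡ-< n h)) })
      (λ (_ , o<n) → inj₂ (+-cancelʳ-< n (p + n) u (subst (_< u + n) (sym e') (+-monoʳ-< u o<n))))
      where
      e' : p + n + n ≡ u + o
      e' = trans (+-assoc p n n) (sym e)
      o>0 : 0 < o
      o>0 = n≢0⇒n>0 λ o≡0 → <⇒≱ u<N (≤-trans (m≤n+m N p)
        (≤-reflexive (trans (sym e) (trans (cong (_+_ u) o≡0) (+-identityʳ u)))))

  ahead-rotate : ∀ {a u p} → a ≤ N → u < N → p < N →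
                 (Ahead (offset a u) (offset a p) ⇔ Ahead u p)
  ahead-rotate {a} {u} {p} a≤N u<N p<N =
    ahead⇔offset (offset<N a u) (offset<N a p)
    ⇔∘ subst (λ o → (0 < o × o < n) ⇔ Ahead u p) (sym (offset-comp p a≤N (<⇒≤ u<N)))
             (⇔-sym (ahead⇔offset u<N p<N))

  -- In the initial segment [0, ℓ) of offsets, a segment avoiding both o and its
  -- antipode o' lies entirely ahead of o or entirely behind it, according to
  -- whether o ≥ n.
  segment-side : ∀ {ℓ o o' e} → o < N → o' < N → o + n ≡ₘ o' → ℓ ≤ o → ℓ ≤ o' → e < ℓ →
                 (Ahead o e ⇔ n ≤ o)
  segment-side {ℓ} {o} {o'} {e} o<N o'<N anti ℓ≤o ℓ≤o' e<ℓ = mk⇔ ahead⇒ ⇒ahead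
    where
    ahead⇒ : Ahead o e → n ≤ o
    ahead⇒ (inj₁ (o<e , _)) = ⊥-elim (<-asym o<e (<-≤-trans e<ℓ ℓ≤o))
    ahead⇒ (inj₂ h) = ≤-trans (m≤n+m n e) (<⇒≤ h)
    ⇒ahead : n ≤ o → Ahead o e
    ⇒ahead n≤o with m≤n⇒∃[o]m+o≡n n≤o
    ... | r , refl = inj₂ (subst (_< n + r) (+-comm n e)
                       (+-monoʳ-< n (<-≤-trans e<ℓ (≤-trans ℓ≤o' (≤-reflexive o'≡r)))))
      where
      o'≡r : o' ≡ r
      o'≡r = ≡ₘ-small o'<N (<-≤-trans (+-cancelˡ-< n r n o<N) (m≤m+n n n))
        (symₘ anti ∙ eqₘ (cong (_+ n) (+-comm n r)) ∙ +n+n r)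

  offset-from-last : ∀ o → o < m + n → offset (m + n) o ≡ suc o
  offset-from-last o o<mn = offset-exact (n≤1+n (m + n)) (s≤s o<mn)
    (inj₂ (trans (+-suc (m + n) o) (trans (cong suc (+-comm (m + n) o)) (sym (+-suc o (m + n))))))

  snoc-arc : ∀ {a ℓ q} {S : ℕ → Set} → a < N → q < N → offset a q ≡ ℓ →
             (∀ p → p < N → (S p ⇔ offset a p < ℓ)) →
             ∀ p → p < N → ((q ≡ p ⊎ S p) ⇔ offset a p < suc ℓ)
  snoc-arc {a} {ℓ} {q} {S} a<N q<N end arc p p<N = mk⇔ ⇒arc arc⇒
    where
    ⇒arc : (q ≡ p ⊎ S p) → offset a p < suc ℓ
    ⇒arc (inj₁ refl) = s≤s (≤-reflexive end)
    ⇒arc (inj₂ s) = m≤n⇒m≤1+n (to (arc p p<N) s)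
    arc⇒ : offset a p < suc ℓ → (q ≡ p ⊎ S p)
    arc⇒ lt with m≤n⇒m<n∨m≡n (s≤s⁻¹ lt)
    ... | inj₁ lt' = inj₂ (from (arc p p<N) lt')
    ... | inj₂ eq = inj₁ (offset-injective (<⇒≤ a<N) q<N p<N (trans end (sym eq)))

  cons-arc : ∀ {a ℓ q} {S : ℕ → Set} → a < N → q < N → offset a q ≡ m + n → ℓ ≤ m + n →
             (∀ p → p < N → (S p ⇔ offset a p < ℓ)) →
             ∀ p → p < N → ((q ≡ p ⊎ S p) ⇔ offset q p < suc ℓ)
  cons-arc {a} {ℓ} {q} {S} a<N q<N start ℓ≤mn arc p p<N = mk⇔ ⇒arc arc⇒
    where
    rebase : offset q p ≡ offset (m + n) (offset a p)
    rebase = sym (trans (cong (λ b → offset b (offset a p)) (sym start))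
                        (offset-comp p (<⇒≤ a<N) (<⇒≤ q<N)))
    ⇒arc : (q ≡ p ⊎ S p) → offset q p < suc ℓ
    ⇒arc (inj₁ refl) = subst (_< suc ℓ) (sym (offset-self q q<N)) z<s
    ⇒arc (inj₂ s) = subst (_< suc ℓ) (sym (trans rebase (offset-from-last _ (<-≤-trans lt ℓ≤mn)))) (s≤s lt)
      where
      lt : offset a p < ℓ
      lt = to (arc p p<N) s
    arc⇒ : offset q p < suc ℓ → (q ≡ p ⊎ S p)
    arc⇒ lt with m≤n⇒m<n∨m≡n (s≤s⁻¹ (offset<N a p))
    ... | inj₂ eq = inj₁ (offset-injective (<⇒≤ a<N) q<N p<N (trans start (sym eq)))
    ... | inj₁ lt' = inj₂ (from (arc p p<N)
          (s≤s⁻¹ (subst (_< suc ℓ) (trans rebase (offset-from-last _ lt')) lt)))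

  Label : ℤ → Set
  Label x = 1 ≤ ∣ x ∣ × ∣ x ∣ ≤ n

  label-neg : ∀ x → Label x → Label (- x)
  label-neg x l rewrite ∣-i∣≡∣i∣ x = l

  pos<N : ∀ x → Label x → pos n x < N
  pos<N (+ zero) (() , _)
  pos<N (+ suc a) (_ , a<n) = ≤-trans a<n (m≤m+n n n)
  pos<N -[1+ k ] (_ , k<n) = +-monoʳ-< n k<n

  pos-abs : ∀ x y → Label x → Label y → pos n x ≡ pos n y → ∣ x ∣ ≡ ∣ y ∣
  pos-abs (+ zero) _ (() , _) _ _
  pos-abs _ (+ zero) _ (() , _) _
  pos-abs (+ suc a) (+ suc b) _ _ e = cong suc e
  pos-abs (+ suc a) -[1+ k ] (_ , a<n) _ e = ⊥-elim (<⇒≱ a<n (≤-trans (m≤m+n n k) (≤-reflexive (sym e))))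
  pos-abs -[1+ k ] (+ suc b) _ (_ , b<n) e = ⊥-elim (<⇒≱ b<n (≤-trans (m≤m+n n k) (≤-reflexive e)))
  pos-abs -[1+ k ] -[1+ k' ] _ _ e = cong suc (+-cancelˡ-≡ n k k' e)

  pos-neg : ∀ x → Label x → pos n x + n ≡ₘ pos n (- x)
  pos-neg (+ zero) (() , _)
  pos-neg (+ suc a) _ = eqₘ (+-comm a n)
  pos-neg -[1+ k ] _ = eqₘ (cong (_+ n) (+-comm n k)) ∙ +n+n k

  -- The half-circle ahead of a label, in each of the four sign cases
  -- (a, b stand for +(a+1), +(b+1) and k, k' for -(k+1), -(k'+1)).
  ahead-++ : ∀ {a b} → a < n → b < n → (Ahead a b ⇔ a < b)
  ahead-++ {a} {b} a<n b<n = mk⇔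
    (λ { (inj₁ (a<b , _)) → a<b
       ; (inj₂ h) → ⊥-elim (<⇒≱ a<n (≤-trans (m≤n+m n b) (<⇒≤ h))) })
    (λ a<b → inj₁ (a<b , ≤-trans b<n (m≤n+m n a)))

  ahead-+- : ∀ {a k} → a < n → (Ahead a (n + k) ⇔ k < a)
  ahead-+- {a} {k} a<n = mk⇔
    (λ { (inj₁ (_ , h)) → +-cancelˡ-< n k a (subst (n + k <_) (+-comm a n) h)
       ; (inj₂ h) → ⊥-elim (<⇒≱ a<n (≤-trans (m≤m+n n k) (≤-trans (m≤m+n (n + k) n) (<⇒≤ h)))) })
    (λ k<a → inj₁ (≤-trans a<n (m≤m+n n k) , subst (n + k <_) (+-comm n a) (+-monoʳ-< n k<a)))

  ahead--+ : ∀ {k b} → b < n → (Ahead (n + k) b ⇔ b < k)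
  ahead--+ {k} {b} b<n = mk⇔
    (λ { (inj₁ (h , _)) → ⊥-elim (<⇒≱ b<n (≤-trans (m≤m+n n k) (<⇒≤ h)))
       ; (inj₂ h) → +-cancelˡ-< n b k (subst (_< n + k) (+-comm b n) h) })
    (λ b<k → inj₂ (subst (_< n + k) (+-comm n b) (+-monoʳ-< n b<k)))

  ahead-- : ∀ {k k'} → k < n → k' < n → (Ahead (n + k) (n + k') ⇔ k < k')
  ahead-- {k} {k'} k<n k'<n = mk⇔
    (λ { (inj₁ (h , _)) → +-cancelˡ-< n k k' h
       ; (inj₂ h) → ⊥-elim (<⇒≱ h (≤-trans (+-monoʳ-≤ n (<⇒≤ k<n)) (+-monoˡ-≤ n (m≤m+n n k')))) })
    (λ k<k' → inj₁ (+-monoʳ-< n k<k' , <-≤-trans (+-monoʳ-< n k'<n) (+-monoˡ-≤ n (m≤m+n n k))))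

  aheadᵇ-correct : ∀ x y → Label x → Label y → ∣ x ∣ ≢ ∣ y ∣ →
                   (T (aheadᵇ x y) ⇔ Ahead (pos n x) (pos n y))
  aheadᵇ-correct (+ zero) _ (() , _) _ _
  aheadᵇ-correct _ (+ zero) _ (() , _) _
  aheadᵇ-correct (+ suc a) (+ suc b) (_ , a<n) (_ , b<n) d =
    T-not-<ᵇ (λ e → d (cong suc e)) ⇔∘ ⇔-sym (ahead-++ a<n b<n)
  aheadᵇ-correct (+ suc a) -[1+ k ] (_ , a<n) _ _ = T-<ᵇ ⇔∘ ⇔-sym (ahead-+- a<n)
  aheadᵇ-correct -[1+ k ] (+ suc b) _ (_ , b<n) _ = T-<ᵇ ⇔∘ ⇔-sym (ahead--+ b<n)
  aheadᵇ-correct -[1+ k ] -[1+ k' ] (_ , k<n) (_ , k'<n) d =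
    T-not-<ᵇ (λ e → d (cong suc e)) ⇔∘ ⇔-sym (ahead-- k<n k'<n)

Unseparated : {n : ℕ} → (Fin n → ℤ) → Set
Unseparated π = ∀ i j k → i <ᶠ j → j <ᶠ k → aheadᵇ (π i) (π j) ≡ aheadᵇ (π i) (π k)

bool-≡⇔ : ∀ {b b' : Bool} → (b ≡ b') ⇔ (T b ⇔ T b')
bool-≡⇔ {b} {b'} = mk⇔ (λ { refl → ⇔-id _ }) (decide b b')
  where
  decide : ∀ b b' → (T b ⇔ T b') → b ≡ b'
  decide false false _ = refl
  decide true true _ = refl
  decide true false f = ⊥-elim (to f _)
  decide false true f = ⊥-elim (from f _)

⇔-cong : ∀ {A A' B B' : Set} → A ⇔ A' → B ⇔ B' → (A ⇔ B) ⇔ (A' ⇔ B')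
⇔-cong f g = mk⇔ (λ h → ⇔-sym f ⇔∘ h ⇔∘ g) (λ h → f ⇔∘ h ⇔∘ ⇔-sym g)

module Permutation (m : ℕ) (π : Fin (suc m) → ℤ) (signed : IsSignedPerm (suc m) π) where
  open Circle m

  label : ∀ i → Label (π i)
  label = proj₁ signed

  abs-injective : ∀ i j → ∣ π i ∣ ≡ ∣ π j ∣ → i ≡ j
  abs-injective = proj₂ signed

  abs-distinct : ∀ {i j} → i <ᶠ j → ∣ π i ∣ ≢ ∣ π j ∣
  abs-distinct i<j e = <-irrefl (cong toℕ (abs-injective _ _ e)) i<j

  abs-pred : ∀ i → suc (pred ∣ π i ∣) ≡ ∣ π i ∣
  abs-pred i with ∣ π i ∣ | label i
  ... | suc _ | _ = refl

  abs-pred<n : ∀ i → pred ∣ π i ∣ < n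
  abs-pred<n i = ≤-trans (≤-reflexive (abs-pred i)) (proj₂ (label i))

  -- |π| is onto {1,…,n}: a missed value would make it an injection into n − 1 values.
  abs-onto : ∀ c → c < n → ∃ λ i → ∣ π i ∣ ≡ suc c
  abs-onto c c<n with any? (λ i → ∣ π i ∣ ≟ℕ suc c)
  ... | yes found = found
  ... | no missed = ⊥-elim (<⇒≱ (n<1+n m) (injective⇒≤ squeeze-injective))
    where
    absFin : Fin n → Fin n
    absFin i = fromℕ< (abs-pred<n i)
    avoids : ∀ i → fromℕ< c<n ≢ absFin i
    avoids i e = missed (i , trans (sym (abs-pred i)) (cong suc
      (trans (sym (toℕ-fromℕ< (abs-pred<n i))) (trans (cong toℕ (sym e)) (toℕ-fromℕ< c<n)))))
    squeeze : Fin n → Fin m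
    squeeze i = punchOut (avoids i)
    squeeze-injective : ∀ {i j} → squeeze i ≡ squeeze j → i ≡ j
    squeeze-injective {i} {j} e = abs-injective i j (trans (sym (abs-pred i))
      (trans (cong suc (fromℕ<-injective _ _ (abs-pred<n i) (abs-pred<n j)
        (punchOut-injective (avoids i) (avoids j) e))) (abs-pred j)))

  position-onto : ∀ q → q < N → ∃ λ i → pos n (π i) ≡ q ⊎ q + n ≡ₘ pos n (π i)
  position-onto q q<N with q <? n
  ... | yes q<n = let (i , e) = abs-onto q q<n in i , low (π i) e
    where
    low : ∀ x → ∣ x ∣ ≡ suc q → pos n x ≡ q ⊎ q + n ≡ₘ pos n x
    low (+ x) e = inj₁ (cong pred e)
    low -[1+ k ] refl = inj₂ (eqₘ (+-comm q n))
  ... | no q≮n with m≤n⇒∃[o]m+o≡n (≮⇒≥ q≮n)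
  ...   | r , refl = let (i , e) = abs-onto r (+-cancelˡ-< n r n q<N) in i , high (π i) e
    where
    high : ∀ x → ∣ x ∣ ≡ suc r → pos n x ≡ n + r ⊎ n + r + n ≡ₘ pos n x
    high (+ x) refl = inj₂ (eqₘ (cong (_+ n) (+-comm n r)) ∙ +n+n r)
    high -[1+ k ] refl = inj₁ refl

  module FromBase {a : ℕ} (a<N : a < N) where

    o : Fin n → ℕ
    o i = offset a (pos n (π i))

    offset-neg : ∀ i → o i + n ≡ₘ offset a (pos n (- π i))
    offset-neg i = offset-shift (<⇒≤ a<N) (pos-neg (π i) (label i))

    offset-onto : ∀ r → r < N → ∃ λ i → o i ≡ r ⊎ r + n ≡ₘ o i
    offset-onto r r<N with position-onto ((a + r) % N) (m%n<n (a + r) N)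
    ... | i , inj₁ e = i , inj₁ (trans (cong (offset a) e) (offset-at a<N r<N))
    ... | i , inj₂ e = i , inj₂ (subst (λ z → z + n ≡ₘ o i) (offset-at a<N r<N)
                                        (offset-shift (<⇒≤ a<N) e))

    aheadᵇ⇔ : ∀ {i j} → ∣ π i ∣ ≢ ∣ π j ∣ → (T (aheadᵇ (π i) (π j)) ⇔ Ahead (o i) (o j))
    aheadᵇ⇔ {i} {j} d = aheadᵇ-correct (π i) (π j) (label i) (label j) d
      ⇔∘ ⇔-sym (ahead-rotate (<⇒≤ a<N) (pos<N (π i) (label i)) (pos<N (π j) (label j)))

    same-side⇔ : ∀ {i j k} → i <ᶠ j → j <ᶠ k →
                 (aheadᵇ (π i) (π j) ≡ aheadᵇ (π i) (π k)) ⇔ (Ahead (o i) (o j) ⇔ Ahead (o i) (o k))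
    same-side⇔ i<j j<k = bool-≡⇔
      ⇔∘ ⇔-cong (aheadᵇ⇔ (abs-distinct i<j)) (aheadᵇ⇔ (abs-distinct (<-trans i<j j<k)))

  -- (1) The tail from j is an arc avoiding π i and -π i (i < j), so it lies
  -- within one half-circle of π i.
  barc⇒unseparated : IsBArc n π → Unseparated π
  barc⇒unseparated barc i j k i<j j<k with barc j
  ... | a , ℓ , a<N , ℓ≤N , tail⇔ = from (same-side⇔ i<j j<k) (side ≤-refl ⇔∘ ⇔-sym (side (<⇒≤ j<k)))
    where
    open FromBase a<N
    arc : ∀ p → p < N → (Tail n π j p ⇔ offset a p < ℓ)
    arc p p<N = tail⇔ p p<N ⇔∘ inArc⇔offset a<N ℓ≤N p<N
    outside : ∀ x → Label x → ∣ x ∣ ≡ ∣ π i ∣ → ℓ ≤ offset a (pos n x)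
    outside x lx same = ≮⇒≥ λ inside → let (k' , j≤k' , e) = from (arc _ (pos<N x lx)) inside in
      <⇒≱ i<j (subst (λ z → j ≤ᶠ z) (abs-injective k' i
        (trans (pos-abs (π k') x (label k') lx e) same)) j≤k')
    side : ∀ {k} → j ≤ᶠ k → (Ahead (o i) (o k) ⇔ n ≤ o i)
    side {k} j≤k = segment-side (offset<N _ _) (offset<N _ _) (offset-neg i)
      (outside (π i) (label i) refl)
      (outside (- π i) (label-neg (π i) (label i)) (∣-i∣≡∣i∣ (π i)))
      (to (arc _ (pos<N (π k) (label k))) (k , j≤k , refl))

  -- The tail {π t, π (t+1), …} as a set of positions; t ranges over ℕ so that
  -- the induction below can start from the empty tail t = n.
  TailFrom : ℕ → ℕ → Set
  TailFrom t p = Σ (Fin n) λ k → t ≤ toℕ k × pos n (π k) ≡ p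

  ArcTail : ℕ → ℕ → Set
  ArcTail t ℓ = Σ ℕ λ a → a < N × (∀ p → p < N → (TailFrom t p ⇔ offset a p < ℓ))

  empty-tail : ∀ t → n ≤ t → ArcTail t 0
  empty-tail t n≤t = 0 , z<s , λ p _ →
    mk⇔ (λ (k , t≤k , _) → ⊥-elim (<⇒≱ (toℕ<n k) (≤-trans n≤t t≤k))) (λ ())

  tail-split : ∀ j p → TailFrom (toℕ j) p ⇔ (pos n (π j) ≡ p ⊎ TailFrom (suc (toℕ j)) p)
  tail-split j p = mk⇔ split join
    where
    split : TailFrom (toℕ j) p → (pos n (π j) ≡ p ⊎ TailFrom (suc (toℕ j)) p)
    split (k , j≤k , e) with m≤n⇒m<n∨m≡n j≤k
    ... | inj₁ j<k = inj₂ (k , j<k , e)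
    ... | inj₂ j≡k = inj₁ (trans (cong (λ z → pos n (π z)) (toℕ-injective j≡k)) e)
    join : (pos n (π j) ≡ p ⊎ TailFrom (suc (toℕ j)) p) → TailFrom (toℕ j) p
    join (inj₁ e) = j , ≤-refl , e
    join (inj₂ (k , j<k , e)) = k , <⇒≤ j<k , e

  module Growth (unseparated : Unseparated π) where

    module Extend (j : Fin n) {d} (size : toℕ j + suc (suc d) ≡ n) {a} (a<N : a < N)
                  (arc : ∀ p → p < N → (TailFrom (suc (toℕ j)) p ⇔ offset a p < suc d)) where
      open FromBase a<N

      ℓ e : ℕ
      ℓ = suc d
      e = o j

      ℓ<n : ℓ < n
      ℓ<n = ≤-trans (m≤n+m (suc ℓ) (toℕ j)) (≤-reflexive size)

      ℓ<N : ℓ < N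
      ℓ<N = ≤-trans ℓ<n (m≤m+n n n)

      j-position : pos n (π j) < N
      j-position = pos<N (π j) (label j)

      same-side : ∀ {i k x y} → i <ᶠ j → j <ᶠ k → o i ≡ x → o k ≡ y → (Ahead x e ⇔ Ahead x y)
      same-side {i} {k} i<j j<k refl refl = to (same-side⇔ i<j j<k) (unseparated i j k i<j j<k)

      outside : ℓ ≤ e
      outside = ≮⇒≥ λ inside → let (k , j<k , same) = from (arc _ j-position) inside in
        <-irrefl (cong toℕ (abs-injective j k (pos-abs (π j) (π k) (label j) (label k) (sym same)))) j<k

      before : ∀ i → ℓ ≤ o i → o i ≢ e → i <ᶠ j
      before i ℓ≤oi oi≢e with <-cmp (toℕ i) (toℕ j)
      ... | tri< i<j _ _ = i<j
      ... | tri≈ _ i≡j _ = ⊥-elim (oi≢e (cong o (toℕ-injective i≡j)))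
      ... | tri> _ _ j<i = ⊥-elim (<⇒≱ (to (arc _ (pos<N (π i) (label i))) (i , j<i , refl)) ℓ≤oi)

      after : ∀ r → r < ℓ → ∃ λ k → j <ᶠ k × o k ≡ r
      after r r<ℓ with from (arc _ (m%n<n (a + r) N))
                            (subst (_< ℓ) (sym (offset-at a<N (<-trans r<ℓ ℓ<N))) r<ℓ)
      ... | k , j<k , at = k , j<k , trans (cong (offset a) at) (offset-at a<N (<-trans r<ℓ ℓ<N))

      -- π j strictly inside the half-circle ahead of the arc: the label at (or
      -- antipodal to) the point just after the arc separates π j from its last point.
      gap-ahead : ℓ < e → e < n → ⊥
      gap-ahead ℓ<e e<n with after d ≤-refl | offset-onto ℓ ℓ<N
      ... | k , j<k , ok | i , inj₁ oi =
        ¬ahead (to (same-side i<j j<k oi ok) (inj₁ (ℓ<e , ≤-trans e<n (m≤n+m n ℓ))))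
        where
        i<j : i <ᶠ j
        i<j = before i (≤-reflexive (sym oi)) (λ eq → <-irrefl (trans (sym oi) eq) ℓ<e)
        ¬ahead : ¬ Ahead ℓ d
        ¬ahead (inj₁ (ℓ<d , _)) = <-asym ℓ<d ≤-refl
        ¬ahead (inj₂ h) = <⇒≱ h (subst (_≤ d + n) (+-comm d 1) (+-monoʳ-≤ d (s≤s z≤n)))
      ... | k , j<k , ok | i , inj₂ anti = ¬ahead (from (same-side i<j j<k oi ok) ahead-d)
        where
        oi : o i ≡ ℓ + n
        oi = sym (≡ₘ-small (+-monoˡ-< n ℓ<n) (offset<N _ _) anti)
        i<j : i <ᶠ j
        i<j = before i (≤-trans (m≤m+n ℓ n) (≤-reflexive (sym oi)))
                       (λ eq → <⇒≱ e<n (≤-trans (m≤n+m n ℓ) (≤-reflexive (trans (sym oi) eq))))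
        ahead-d : Ahead (ℓ + n) d
        ahead-d = inj₂ ≤-refl
        ¬ahead : ¬ Ahead (ℓ + n) e
        ¬ahead (inj₁ (h , _)) = <-asym h (≤-trans e<n (m≤n+m n ℓ))
        ¬ahead (inj₂ h) = <-asym ℓ<e (+-cancelʳ-< n e ℓ h)

      -- π j strictly inside the half-circle behind the arc: symmetrically, the
      -- label at (or antipodal to) the point just before the arc separates π j
      -- from its first point.
      gap-behind : n ≤ e → e < m + n → ⊥
      gap-behind n≤e e<mn with after 0 z<s | offset-onto (m + n) (n<1+n (m + n))
      ... | k , j<k , ok | i , inj₁ oi = ¬ahead (from (same-side i<j j<k oi ok) (inj₂ (+-monoˡ-< n m>0)))
        where
        m>0 : 0 < m
        m>0 = <-≤-trans z<s (s≤s⁻¹ ℓ<n)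
        i<j : i <ᶠ j
        i<j = before i (≤-trans (<⇒≤ ℓ<n) (≤-trans (m≤n+m n m) (≤-reflexive (sym oi))))
                       (λ eq → <-irrefl (trans (sym eq) oi) e<mn)
        ¬ahead : ¬ Ahead (m + n) e
        ¬ahead (inj₁ (h , _)) = <-asym h e<mn
        ¬ahead (inj₂ h) = <⇒≱ (+-cancelʳ-< n e m h) (<⇒≤ n≤e)
      ... | k , j<k , ok | i , inj₂ anti = ¬ahead (to (same-side i<j j<k oi ok) (inj₁ (n≤e , e<mn)))
        where
        oi : o i ≡ m
        oi = ≡ₘ-small (offset<N _ _) (≤-trans (n<1+n m) (m≤m+n n n)) (symₘ anti ∙ +n+n m)
        i<j : i <ᶠ j
        i<j = before i (≤-trans (s≤s⁻¹ ℓ<n) (≤-reflexive (sym oi)))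
                       (λ eq → <⇒≱ n≤e (≤-reflexive (trans (sym eq) oi)))
        ¬ahead : ¬ Ahead m 0
        ¬ahead (inj₂ h) = <-asym h (n<1+n m)

      -- π j sits just after or just before the arc; anywhere else it would be separated.
      extended : ArcTail (toℕ j) (suc ℓ)
      extended with <-cmp e ℓ
      ... | tri< e<ℓ _ _ = ⊥-elim (<⇒≱ e<ℓ outside)
      ... | tri≈ _ e≡ℓ _ = a , a<N , λ p p<N →
            tail-split j p ⇔∘ snoc-arc a<N j-position e≡ℓ arc p p<N
      ... | tri> _ _ ℓ<e with <-cmp e (m + n)
      ...   | tri≈ _ e≡mn _ = pos n (π j) , j-position , λ p p<N →
              tail-split j p ⇔∘ cons-arc a<N j-position e≡mn (≤-trans (<⇒≤ ℓ<n) (m≤n+m n m)) arc p p<N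
      ...   | tri> _ _ mn<e = ⊥-elim (<⇒≱ mn<e (s≤s⁻¹ (offset<N a _)))
      ...   | tri< e<mn _ _ with e <? n
      ...     | yes e<n = ⊥-elim (gap-ahead ℓ<e e<n)
      ...     | no e≮n = ⊥-elim (gap-behind (≮⇒≥ e≮n) e<mn)

    -- Adjoining π j to the arc tail {π(j+1),…} of length ℓ; an empty tail is
    -- the empty arc at any base point, so the new arc starts at π j.
    grow : ∀ {t} (j : Fin n) → toℕ j ≡ t → ∀ {ℓ} → t + suc ℓ ≡ n →
           ArcTail (suc t) ℓ → ArcTail t (suc ℓ)
    grow j refl {zero} _ (a , _ , arc) = p , p<N , λ q q<N →
      tail-split j q ⇔∘ snoc-arc p<N p<N (offset-self p p<N) empty q q<N
      where
      p : ℕ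
      p = pos n (π j)
      p<N : p < N
      p<N = pos<N (π j) (label j)
      empty : ∀ q → q < N → (TailFrom (suc (toℕ j)) q ⇔ offset p q < 0)
      empty q q<N = mk⇔ (λ s → ⊥-elim (<⇒≱ (to (arc q q<N) s) z≤n)) (λ ())
    grow j refl {suc d} size (a , a<N , arc) = Extend.extended j size a<N arc

    tails : ∀ ℓ t → t + ℓ ≡ n → ArcTail t ℓ
    tails zero t size = empty-tail t (≤-reflexive (trans (sym size) (+-identityʳ t)))
    tails (suc ℓ) t size =
      grow (fromℕ< t<n) (toℕ-fromℕ< t<n) size (tails ℓ (suc t) (trans (sym (+-suc t ℓ)) size))
      where
      t<n : t < n
      t<n = <-≤-trans (m<m+n t z<s) (≤-reflexive size)

    unseparated⇒barc : IsBArc n π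
    unseparated⇒barc j with tails (n ∸ toℕ j) (toℕ j) (m+[n∸m]≡n (<⇒≤ (toℕ<n j)))
    ... | a , a<N , arc = a , n ∸ toℕ j , a<N , ℓ≤N , λ p p<N →
          arc p p<N ⇔∘ ⇔-sym (inArc⇔offset a<N ℓ≤N p<N)
      where
      ℓ≤N : n ∸ toℕ j ≤ N
      ℓ≤N = ≤-trans (m∸n≤m n (toℕ j)) (m≤m+n n n)

f0 f1 f2 : Fin 3
f0 = zero
f1 = suc zero
f2 = suc (suc zero)

Separated : (Fin 3 → ℤ) → Set
Separated σ = aheadᵇ (σ f0) (σ f1) ≢ aheadᵇ (σ f0) (σ f2)

separated? : ∀ σ → Dec (Separated σ)
separated? σ = ¬? (aheadᵇ (σ f0) (σ f1) Bool.≟ aheadᵇ (σ f0) (σ f2))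

patterns-separated : All (λ v → Separated (lookup v)) patterns
patterns-separated = toWitness {a? = all? (λ v → separated? (lookup v)) patterns} _

-- aheadᵇ only sees the signs and the relative order of absolute values,
-- so it is invariant under pattern occurrences.
aheadᵇ-invariant : ∀ {x y x' y'} → sign x ≡ sign x' → sign y ≡ sign y' →
                   (∣ y ∣ < ∣ x ∣ ⇔ ∣ y' ∣ < ∣ x' ∣) → aheadᵇ x y ≡ aheadᵇ x' y'
aheadᵇ-invariant {x} {y} {x'} {y'} sx sy order rewrite sx | sy =
  cong (⌊ sign x' Sign.≟ sign y' ⌋ xor_) (from bool-≡⇔ (T-<ᵇ ⇔∘ order ⇔∘ ⇔-sym T-<ᵇ))

occurrence-separated : ∀ {n} (π : Fin n → ℤ) σ → Contains π σ → Separated σ → ¬ Unseparated π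
occurrence-separated π σ (f , mono , sg , ord) sep unseparated =
  sep (trans (sym (invariant f1))
    (trans (unseparated (f f0) (f f1) (f f2) (mono f0 f1 z<s) (mono f1 f2 (s<s z<s))) (invariant f2)))
  where
  invariant : ∀ b → aheadᵇ (π (f f0)) (π (f b)) ≡ aheadᵇ (σ f0) (σ b)
  invariant b = aheadᵇ-invariant (sg f0) (sg b) (ord b f0)

unseparated⇒avoids : ∀ {n} (π : Fin n → ℤ) → Unseparated π → All (λ v → Avoids π (lookup v)) patterns
unseparated⇒avoids π unseparated =
  All.map (λ {v} sep occurrence → occurrence-separated π (lookup v) occurrence sep unseparated) patterns-separated

-- The six orderings of three distinct numbers: under τ the r-th smallest entry
-- sits at index ρ τ r, and rank τ is the inverse of ρ τ.
data Order3 : Set where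
  o012 o021 o102 o120 o201 o210 : Order3

ρ rank : Order3 → Fin 3 → Fin 3
ρ o012 = lookup (f0 ∷ f1 ∷ f2 ∷ [])
ρ o021 = lookup (f0 ∷ f2 ∷ f1 ∷ [])
ρ o102 = lookup (f1 ∷ f0 ∷ f2 ∷ [])
ρ o120 = lookup (f1 ∷ f2 ∷ f0 ∷ [])
ρ o201 = lookup (f2 ∷ f0 ∷ f1 ∷ [])
ρ o210 = lookup (f2 ∷ f1 ∷ f0 ∷ [])
rank o012 = ρ o012
rank o021 = ρ o021
rank o102 = ρ o102
rank o120 = ρ o201
rank o201 = ρ o120
rank o210 = ρ o210

orders : List Order3
orders = o012 ∷ o021 ∷ o102 ∷ o120 ∷ o201 ∷ o210 ∷ []

every-order : ∀ τ → τ ∈ orders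
every-order o012 = here refl
every-order o021 = there (here refl)
every-order o102 = there (there (here refl))
every-order o120 = there (there (there (here refl)))
every-order o201 = there (there (there (there (here refl))))
every-order o210 = there (there (there (there (there (here refl)))))

ρ-rank : ∀ τ a → ρ τ (rank τ a) ≡ a
ρ-rank τ = All.lookup
  (toWitness {a? = all? (λ τ → all-fin? λ a → ρ τ (rank τ a) ≟ᶠ a) orders} _) (every-order τ)

Increasing : (Fin 3 → ℕ) → Set
Increasing s = s f0 < s f1 × s f1 < s f2

increasing⇔ : ∀ {s} → Increasing s → ∀ a b → (s a < s b ⇔ toℕ a < toℕ b)
increasing⇔ _ zero zero = mk⇔ (λ h → ⊥-elim (<-irrefl refl h)) (λ ())
increasing⇔ (s01 , _) zero (suc zero) = mk⇔ (λ _ → z<s) (λ _ → s01)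
increasing⇔ (s01 , s12) zero (suc (suc zero)) = mk⇔ (λ _ → z<s) (λ _ → <-trans s01 s12)
increasing⇔ (s01 , _) (suc zero) zero = mk⇔ (λ h → ⊥-elim (<-asym h s01)) (λ ())
increasing⇔ _ (suc zero) (suc zero) = mk⇔ (λ h → ⊥-elim (<-irrefl refl h)) (λ { (s<s ()) })
increasing⇔ (_ , s12) (suc zero) (suc (suc zero)) = mk⇔ (λ _ → s<s z<s) (λ _ → s12)
increasing⇔ (s01 , s12) (suc (suc zero)) zero = mk⇔ (λ h → ⊥-elim (<-asym h (<-trans s01 s12))) (λ ())
increasing⇔ (_ , s12) (suc (suc zero)) (suc zero) = mk⇔ (λ h → ⊥-elim (<-asym h s12)) (λ { (s<s ()) })
increasing⇔ _ (suc (suc zero)) (suc (suc zero)) = mk⇔ (λ h → ⊥-elim (<-irrefl refl h)) (λ { (s<s (s<s ())) })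

sort3 : ∀ (u : Fin 3 → ℕ) → u f0 ≢ u f1 → u f0 ≢ u f2 → u f1 ≢ u f2 →
        Σ Order3 λ τ → Increasing (λ r → u (ρ τ r))
sort3 u d01 d02 d12 with <-cmp (u f0) (u f1) | <-cmp (u f1) (u f2)
... | tri≈ _ e _ | _ = ⊥-elim (d01 e)
... | _ | tri≈ _ e _ = ⊥-elim (d12 e)
... | tri< a _ _ | tri< b _ _ = o012 , a , b
... | tri> _ _ a | tri> _ _ b = o210 , b , a
... | tri< a _ _ | tri> _ _ b with <-cmp (u f0) (u f2)
...   | tri< c _ _ = o021 , c , b
...   | tri≈ _ e _ = ⊥-elim (d02 e)
...   | tri> _ _ c = o201 , c , a
sort3 u d01 d02 d12 | tri> _ _ a | tri< b _ _ with <-cmp (u f0) (u f2)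
...   | tri< c _ _ = o102 , a , c
...   | tri≈ _ e _ = ⊥-elim (d02 e)
...   | tri> _ _ c = o120 , b , c

rank-order : ∀ τ {u : Fin 3 → ℕ} → Increasing (λ r → u (ρ τ r)) →
             ∀ a b → (u a < u b ⇔ toℕ (rank τ a) < toℕ (rank τ b))
rank-order τ {u} inc a b =
  subst₂ (λ x y → (u x < u y) ⇔ (toℕ (rank τ a) < toℕ (rank τ b))) (ρ-rank τ a) (ρ-rank τ b)
    (increasing⇔ {λ r → u (ρ τ r)} inc (rank τ a) (rank τ b))

canonical : Sign → Sign → Sign → Order3 → Vec ℤ 3
canonical s0 s1 s2 τ =
  (s0 ◃ suc (toℕ (rank τ f0))) ∷ (s1 ◃ suc (toℕ (rank τ f1))) ∷ (s2 ◃ suc (toℕ (rank τ f2))) ∷ []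

signs : List Sign
signs = Sign.+ ∷ Sign.- ∷ []

every-sign : ∀ s → s ∈ signs
every-sign Sign.+ = here refl
every-sign Sign.- = there (here refl)

Listed : Sign → Sign → Sign → Order3 → Set
Listed s0 s1 s2 τ = Separated (lookup (canonical s0 s1 s2 τ)) → canonical s0 s1 s2 τ ∈ patterns

listed : ∀ s0 s1 s2 τ → Listed s0 s1 s2 τ
listed s0 s1 s2 τ = All.lookup (All.lookup (All.lookup (All.lookup all-listed
  (every-sign s0)) (every-sign s1)) (every-sign s2)) (every-order τ)
  where
  all-listed : All (λ s0 → All (λ s1 → All (λ s2 → All (Listed s0 s1 s2) orders) signs) signs) signs
  all-listed = toWitness {a? = all? (λ s0 → all? (λ s1 → all? (λ s2 → all? (λ τ →
    separated? (lookup (canonical s0 s1 s2 τ)) →-dec (canonical s0 s1 s2 τ ∈? patterns))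
    orders) signs) signs) signs} _

-- A separated triple i < j < k of a signed word with distinct absolute values
-- is an occurrence of its standardisation, which is a listed pattern.
avoids⇒unseparated : ∀ {n} (π : Fin n → ℤ) → (∀ i j → ∣ π i ∣ ≡ ∣ π j ∣ → i ≡ j) →
                     All (λ v → Avoids π (lookup v)) patterns → Unseparated π
avoids⇒unseparated π abs-injective avoids i j k i<j j<k
  with aheadᵇ (π i) (π j) Bool.≟ aheadᵇ (π i) (π k)
... | yes same = same
... | no sep = ⊥-elim (All.lookup avoids (listed (s f0) (s f1) (s f2) τ separated) (f , mono , sg , order))
  where
  f : Fin 3 → Fin _
  f = lookup (i ∷ j ∷ k ∷ [])
  s : Fin 3 → Sign
  s a = sign (π (f a))
  u : Fin 3 → ℕ
  u a = ∣ π (f a) ∣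
  distinct : ∀ {a b} → a <ᶠ b → ∣ π a ∣ ≢ ∣ π b ∣
  distinct a<b e = <-irrefl (cong toℕ (abs-injective _ _ e)) a<b
  sorted : Σ Order3 λ τ → Increasing (λ r → u (ρ τ r))
  sorted = sort3 u (distinct i<j) (distinct (<-trans i<j j<k)) (distinct j<k)
  τ : Order3
  τ = proj₁ sorted
  σ : Fin 3 → ℤ
  σ = lookup (canonical (s f0) (s f1) (s f2) τ)
  mono : ∀ a b → a <ᶠ b → f a <ᶠ f b
  mono zero (suc zero) _ = i<j
  mono zero (suc (suc zero)) _ = <-trans i<j j<k
  mono (suc zero) (suc (suc zero)) _ = j<k
  mono _ zero ()
  mono (suc zero) (suc zero) (s<s ())
  mono (suc (suc zero)) (suc zero) (s<s ())
  mono (suc (suc zero)) (suc (suc zero)) (s<s (s<s ()))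
  sg : ∀ a → sign (π (f a)) ≡ sign (σ a)
  sg zero = sym (sign-◃ (s f0) _)
  sg (suc zero) = sym (sign-◃ (s f1) _)
  sg (suc (suc zero)) = sym (sign-◃ (s f2) _)
  abs-σ : ∀ a → ∣ σ a ∣ ≡ suc (toℕ (rank τ a))
  abs-σ zero = abs-◃ (s f0) _
  abs-σ (suc zero) = abs-◃ (s f1) _
  abs-σ (suc (suc zero)) = abs-◃ (s f2) _
  order : ∀ a b → (u a < u b ⇔ ∣ σ a ∣ < ∣ σ b ∣)
  order a b = rank-order τ (proj₂ sorted) a b
    ⇔∘ subst₂ (λ x y → (toℕ (rank τ a) < toℕ (rank τ b)) ⇔ x < y) (sym (abs-σ a)) (sym (abs-σ b))
              (mk⇔ s<s s<s⁻¹)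
  separated : Separated σ
  separated e = sep (trans (aheadᵇ-invariant (sg f0) (sg f1) (order f1 f0))
    (trans e (sym (aheadᵇ-invariant (sg f0) (sg f2) (order f2 f0)))))

theorem5p5 : (n : ℕ) (π : Fin n → ℤ) → IsSignedPerm n π →
    (IsBArc n π ⇔ All (λ σ → Avoids π (lookup σ)) patterns)
theorem5p5 zero π _ = mk⇔ (λ _ → unseparated⇒avoids π (λ ())) (λ _ ())
theorem5p5 (suc m) π signed = mk⇔
  (λ barc → unseparated⇒avoids π (barc⇒unseparated barc))
  (λ avoids → Growth.unseparated⇒barc (avoids⇒unseparated π abs-injective avoids))
  where open Permutation m π signed
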